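{- For every integer $k \geq 2$ and for each of the three problems \textsc{Vertex Cover}, \textsc{Dominating Set}, and \textsc{Independent Set}, there exists a connected graph $G$ and two solutions of size $k$ of that problem on $G$ such that neither can be reached from the other by a reconfiguration sequence under $(k-1,d)$-Token Jumping, for every integer $d \geq 1$.
   Context: Graphs are finite and simple. A configuration is a set of $k$ vertices (tokens on distinct vertices). For a problem $\Pi$, $\Pi(G)$ denotes the feasible solutions of size $k$ (vertex covers, dominating sets, or independent sets of size $k$). A move under $(k',d)$-Token Jumping from a configuration $D$ to a configuration $D'$ is a bijection $f : D \to D'$ such that $f(v) \neq v$ for at most $k'$ vertices $v \in D$ and $\mathrm{dist}_G(v,f(v)) \leq d$ for all $v \in D$. A reconfiguration sequence under a rule is a sequence $D_1,\dots,D_\ell$ with every $D_i \in \Pi(G)$ and a move under the rule from $D_i$ to $D_{i+1}$ for all $i<\ell$. -}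

module Defs where

open import Data.Nat using (ℕ; zero; suc; _≤_)
open import Data.Bool using (Bool; true; false; _∧_; not)
open import Data.Fin using (Fin)
import Data.Fin.Properties as FinP
open import Data.Fin.Subset using (Subset; _∈_; ∣_∣)
open import Data.Fin.Subset.Properties using (_∈?_)
open import Data.Vec using (tabulate)
open import Data.Product using (Σ; ∃; _×_; _,_)
open import Data.Sum using (_⊎_)
open import Relation.Nullary using (¬_; does)
open import Relation.Binary.PropositionalEquality using (_≡_)

record Graph : Set where
  field
    n      : ℕ
    adj    : Fin n → Fin n → Bool
    sym    : ∀ u v → adj u v ≡ adj v u
    irrefl : ∀ v → adj v v ≡ false
open Graph public

Vertex : Graph → Set
Vertex G = Fin (n G)

data Walk (G : Graph) : ℕ → Vertex G → Vertex G → Set where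
  here : ∀ {v} → Walk G zero v v
  step : ∀ {ℓ u w v} → adj G u w ≡ true → Walk G ℓ w v → Walk G (suc ℓ) u v

DistLE : (G : Graph) → Vertex G → Vertex G → ℕ → Set
DistLE G u v d = Σ ℕ λ ℓ → ℓ ≤ d × Walk G ℓ u v

Connected : Graph → Set
Connected G = ∀ (u v : Vertex G) → Σ ℕ λ ℓ → Walk G ℓ u v

Config : Graph → Set
Config G = Subset (n G)

data Problem : Set where
  VertexCover DominatingSet IndependentSet : Problem

IsFeasible : Problem → (G : Graph) → Config G → Set
IsFeasible VertexCover G D =
  ∀ u v → adj G u v ≡ true → u ∈ D ⊎ v ∈ D
IsFeasible DominatingSet G D =
  ∀ v → v ∈ D ⊎ (Σ (Vertex G) λ u → u ∈ D × adj G u v ≡ true)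
IsFeasible IndependentSet G D =
  ∀ u v → u ∈ D → v ∈ D → adj G u v ≡ false

Sol : Problem → (G : Graph) → ℕ → Config G → Set
Sol Π G k D = IsFeasible Π G D × ∣ D ∣ ≡ k

moved : (G : Graph) → (Vertex G → Vertex G) → Config G → Config G
moved G f D = tabulate λ v → does (v ∈? D) ∧ not (does (f v FinP.≟ v))

-- A move under (k',d)-Token Jumping from D to D': a bijection f : D → D'
-- (given as a function on vertices whose restriction to D is a bijection onto D')
-- moving at most k' tokens, each by distance at most d.
TJMove : (G : Graph) → ℕ → ℕ → Config G → Config G → Set
TJMove G k' d D D' =
  Σ (Vertex G → Vertex G) λ f →
    (∀ v → v ∈ D → f v ∈ D') ×
    (∀ u v → u ∈ D → v ∈ D → f u ≡ f v → u ≡ v) ×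
    (∀ w → w ∈ D' → Σ (Vertex G) λ v → v ∈ D × f v ≡ w) ×
    (∣ moved G f D ∣ ≤ k') ×
    (∀ v → v ∈ D → DistLE G v (f v) d)

data Reconf (Π : Problem) (G : Graph) (k k' d : ℕ) : Config G → Config G → Set where
  done : ∀ {D} → Sol Π G k D → Reconf Π G k k' d D D
  next : ∀ {D D' D''} → Sol Π G k D → TJMove G k' d D D' →
         Reconf Π G k k' d D' D'' → Reconf Π G k k' d D D''

{-# OPTIONS --safe #-}
-- Call a size-k solution D rigid if every size-k solution sharing a vertex with D is D
-- itself. A move of at most k - 1 tokens leaves some token of D in place, so from a rigid D
-- nothing but D is reachable, and two distinct rigid solutions are mutually unreachable
-- whatever the jump distance.
-- In K_{k,k} both sides are rigid vertex covers and rigid independent sets: an independent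
-- set meeting side s lies inside it, and a vertex cover meeting side s but missing one of
-- its vertices contains the whole other side too, k + 1 vertices. For domination, add for
-- every pair (p , q) a vertex adjacent exactly to the p-th vertex of one side and the q-th
-- of the other: a dominating set missing the l-th vertex of side s must contain, for each j,
-- the j-th vertex of the other side or the pair vertex of (l , j), so it has k vertices off
-- side s and cannot meet side s as well.

module Submission where

open import Defs hiding (sym)
open import Data.Bool using (Bool; true; false; not; _xor_)
open import Data.Bool.Properties using (xor-comm; xor-same; not-¬) renaming (_≟_ to _≟ᵇ_)
open import Data.Fin using (Fin; zero; suc)
open import Data.Fin.Properties using (0≢1+n; suc-injective; ¬Fin0; any?; 2↔Bool; *↔×; +↔⊎)
  renaming (_≟_ to _≟ᶠ_)
open import Data.Fin.Subset using (Subset; _∈_; _∉_; _⊆_; _⊂_; _─_; _-_; ∣_∣; inside; outside)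
open import Data.Fin.Subset.Properties
  using (_∈?_; p⊆q⇒∣p∣≤∣q∣; p⊂q⇒∣p∣<∣q∣; ⊆-antisym; ∣⊥∣≡0; Empty-unique; p─⊥≡p; p─q⊆p;
         x∈p∧x≢y⇒x∈p-y; x∈p∧x∉q⇒x∈p─q; x∈p⇒∣p-x∣<∣p∣; x∈p∩q⁺; p∩q≢∅⇒∣p─q∣<∣p∣)
open import Data.Maybe using (Maybe; just; nothing)
open import Data.Maybe.Properties using (just-injective) renaming (≡-dec to ≡-decᵐ)
open import Data.Nat using (ℕ; zero; suc; _≤_; _<_; _∸_; _*_; z≤n; s≤s)
open import Data.Nat.Properties
  using (≤-refl; ≤-trans; ≤-reflexive; ≤-antisym; n≤1+n; n<1+n; ≤⇒≯; <⇒≱)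
open import Data.Product using (Σ; ∃; _×_; _,_; proj₁; proj₂)
open import Data.Product.Function.NonDependent.Propositional using (_×-↔_)
open import Data.Sum using (_⊎_; inj₁; inj₂; [_,_]′)
import Data.Sum as Sum
open import Data.Sum.Function.Propositional using (_⊎-↔_)
open import Data.Sum.Properties using (inj₁-injective)
open import Data.Vec using (_∷_; tabulate; there)
open import Data.Vec.Properties using (lookup∘tabulate; []=⇒lookup; lookup⇒[]=)
open import Function using (_∘_; id; flip)
open import Function.Bundles using (Inverse; _↔_)
open import Function.Definitions using (Injective)
open import Function.Properties.Inverse using (↔-refl; ↔-sym; ↔-trans)
open import Relation.Nullary using (¬_; Dec; yes; no; does; contradiction; ¬?)
open import Relation.Nullary.Decidable using (dec-true; _×-dec_)
open import Relation.Unary using (Pred; Decidable)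
open import Relation.Binary.PropositionalEquality
  using (_≡_; _≢_; refl; sym; trans; cong; subst; subst₂; module ≡-Reasoning)

∣p∣≤1+∣p-x∣ : ∀ {n} (p : Subset n) x → ∣ p ∣ ≤ suc ∣ p - x ∣
∣p∣≤1+∣p-x∣ (outside ∷ p) zero    = subst (λ q → ∣ p ∣ ≤ suc ∣ q ∣) (sym (p─⊥≡p p)) (n≤1+n ∣ p ∣)
∣p∣≤1+∣p-x∣ (inside  ∷ p) zero    = subst (λ q → suc ∣ p ∣ ≤ suc ∣ q ∣) (sym (p─⊥≡p p)) ≤-refl
∣p∣≤1+∣p-x∣ (outside ∷ p) (suc x) = ∣p∣≤1+∣p-x∣ p x
∣p∣≤1+∣p-x∣ (inside  ∷ p) (suc x) = s≤s (∣p∣≤1+∣p-x∣ p x)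

x∉p-x : ∀ {n} {p : Subset n} x → x ∉ p - x
x∉p-x {p = _ ∷ _} zero    ()
x∉p-x {p = _ ∷ _} (suc x) (there x∈p-x) = x∉p-x x x∈p-x

injective⇒m≤∣p∣ : ∀ {m n} (g : Fin m → Fin n) → Injective _≡_ _≡_ g →
                  (p : Subset n) → (∀ i → g i ∈ p) → m ≤ ∣ p ∣
injective⇒m≤∣p∣ {zero}  g g-inj p g∈p = z≤n
injective⇒m≤∣p∣ {suc m} g g-inj p g∈p =
  ≤-trans (s≤s (injective⇒m≤∣p∣ (g ∘ suc) (λ e → suc-injective (g-inj e)) (p - g zero) g∘suc∈p-g0))
          (x∈p⇒∣p-x∣<∣p∣ (g∈p zero))
  where
  g∘suc∈p-g0 : ∀ i → g (suc i) ∈ p - g zero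
  g∘suc∈p-g0 i = x∈p∧x≢y⇒x∈p-y (g∈p (suc i)) (λ e → 0≢1+n (sym (g-inj e)))

covering⇒∣p∣≤m : ∀ {m n} (g : Fin m → Fin n) (p : Subset n) →
                 (∀ {x} → x ∈ p → ∃ λ i → g i ≡ x) → ∣ p ∣ ≤ m
covering⇒∣p∣≤m {zero} {n} g p cover =
  ≤-reflexive (trans (cong ∣_∣ (Empty-unique (λ (_ , x∈p) → ¬Fin0 (proj₁ (cover x∈p))))) (∣⊥∣≡0 n))
covering⇒∣p∣≤m {suc m} g p cover =
  ≤-trans (∣p∣≤1+∣p-x∣ p (g zero)) (s≤s (covering⇒∣p∣≤m (g ∘ suc) (p - g zero) cover′))
  where
  cover′ : ∀ {x} → x ∈ p - g zero → ∃ λ i → g (suc i) ≡ x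
  cover′ x∈p-g0 with cover (p─q⊆p p _ x∈p-g0)
  ... | zero  , refl = contradiction x∈p-g0 (x∉p-x (g zero))
  ... | suc i , gi≡x = i , gi≡x

bijection⇒∣p∣≡m : ∀ {m n} (g : Fin m → Fin n) → Injective _≡_ _≡_ g → (p : Subset n) →
                  (∀ i → g i ∈ p) → (∀ {x} → x ∈ p → ∃ λ i → g i ≡ x) → ∣ p ∣ ≡ m
bijection⇒∣p∣≡m g g-inj p g∈p cover =
  ≤-antisym (covering⇒∣p∣≤m g p cover) (injective⇒m≤∣p∣ g g-inj p g∈p)

p⊆q∧∣q∣≤∣p∣⇒p≡q : ∀ {n} {p q : Subset n} → p ⊆ q → ∣ q ∣ ≤ ∣ p ∣ → p ≡ q
p⊆q∧∣q∣≤∣p∣⇒p≡q {p = p} {q} p⊆q ∣q∣≤∣p∣ = ⊆-antisym p⊆q q⊆p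
  where
  q⊆p : q ⊆ p
  q⊆p {x} x∈q with x ∈? p
  ... | yes x∈p = x∈p
  ... | no  x∉p = contradiction (p⊂q⇒∣p∣<∣q∣ (p⊆q , x , x∈q , x∉p)) (≤⇒≯ ∣q∣≤∣p∣)

subsetOf : ∀ {n ℓ} {P : Pred (Fin n) ℓ} → Decidable P → Subset n
subsetOf P? = tabulate (λ x → does (P? x))

∈-subsetOf⁺ : ∀ {n ℓ} {P : Pred (Fin n) ℓ} (P? : Decidable P) {x} → P x → x ∈ subsetOf P?
∈-subsetOf⁺ P? {x} px = lookup⇒[]= x _ (trans (lookup∘tabulate _ x) (dec-true (P? x) px))

∈-subsetOf⁻ : ∀ {n ℓ} {P : Pred (Fin n) ℓ} (P? : Decidable P) {x} → x ∈ subsetOf P? → P x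
∈-subsetOf⁻ P? {x} x∈P
  with P? x | trans (sym (lookup∘tabulate (λ y → does (P? y)) x)) ([]=⇒lookup x∈P)
... | yes px | _ = px
... | no  _  | ()

Reachable : (G : Graph) → Vertex G → Vertex G → Set
Reachable G u v = Σ ℕ λ ℓ → Walk G ℓ u v

reachable-refl : ∀ {G v} → Reachable G v v
reachable-refl = zero , here

infixr 5 _◅_
_◅_ : ∀ {G u w v} → adj G u w ≡ true → Reachable G w v → Reachable G u v
uw ◅ (ℓ , walk) = suc ℓ , step uw walk

reachable-trans : ∀ {G u v w} → Reachable G u v → Reachable G v w → Reachable G u w
reachable-trans (zero  , here)        r = r
reachable-trans (suc ℓ , step uw walk) r = uw ◅ reachable-trans (ℓ , walk) r

reachable-sym : ∀ {G u v} → Reachable G u v → Reachable G v u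
reachable-sym     (zero  , here)                         = reachable-refl
reachable-sym {G} (suc ℓ , step {u = u} {w = w} uw walk) =
  reachable-trans (reachable-sym (ℓ , walk)) (trans (Graph.sym G w u) uw ◅ reachable-refl)

hub⇒connected : (G : Graph) (h : Vertex G) → (∀ v → Reachable G v h) → Connected G
hub⇒connected G h reach u v = reachable-trans (reach u) (reachable-sym (reach v))

source-sol : ∀ {Π G k k′ d D D″} → Reconf Π G k k′ d D D″ → Sol Π G k D
source-sol (done D∈Π)     = D∈Π
source-sol (next D∈Π _ _) = D∈Π

fixed-token : ∀ {G k′ d D D′} → TJMove G k′ d D D′ → k′ < ∣ D ∣ → ∃ λ v → v ∈ D × v ∈ D′
fixed-token {G} {D = D} {D′} (f , f∈D′ , _ , _ , ∣moved∣≤k′ , _) k′<∣D∣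
  with any? (λ v → (v ∈? D) ×-dec (f v ≟ᶠ v))
... | yes (v , v∈D , fv≡v) = v , v∈D , subst (_∈ D′) fv≡v (f∈D′ v v∈D)
... | no  ¬fixed           =
  contradiction (≤-trans (p⊆q⇒∣p∣≤∣q∣ D⊆moved) ∣moved∣≤k′) (<⇒≱ k′<∣D∣)
  where
  D⊆moved : D ⊆ moved G f D
  D⊆moved {v} v∈D =
    ∈-subsetOf⁺ (λ v → (v ∈? D) ×-dec ¬? (f v ≟ᶠ v)) (v∈D , λ fv≡v → ¬fixed (v , v∈D , fv≡v))

Rigid : Problem → (G : Graph) → ℕ → Config G → Set
Rigid Π G k D = ∀ {D′} → Sol Π G k D′ → ∀ {v} → v ∈ D → v ∈ D′ → D′ ≡ D

reconf-from-rigid : ∀ {Π G k k′ d D D″} → Rigid Π G k D → k′ < k → Reconf Π G k k′ d D D″ → D″ ≡ D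
reconf-from-rigid rigid k′<k (done _) = refl
reconf-from-rigid rigid k′<k (next (_ , ∣D∣≡k) move rest)
  with fixed-token move (subst (_ <_) (sym ∣D∣≡k) k′<k)
... | v , v∈D , v∈D′ with rigid (source-sol rest) v∈D v∈D′
...   | refl = reconf-from-rigid rigid k′<k rest

record RigidPair (Π : Problem) (k : ℕ) : Set where
  field
    graph      : Graph
    connected  : Connected graph
    S          : Bool → Config graph
    S-sol      : ∀ s → Sol Π graph k (S s)
    S-rigid    : ∀ s → Rigid Π graph k (S s)
    S-distinct : S true ≢ S false

module EnumeratedGraph {V : Set} {N : ℕ} (enum : V ↔ Fin N) (E : V → V → Bool)
                       (E-sym : ∀ x y → E x y ≡ E y x) (E-irrefl : ∀ x → E x x ≡ false) where

  open Inverse enum public using (to; from; strictlyInverseˡ; strictlyInverseʳ)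

  G : Graph
  G = record
    { n      = N
    ; adj    = λ u v → E (from u) (from v)
    ; sym    = λ u v → E-sym (from u) (from v)
    ; irrefl = λ v → E-irrefl (from v)
    }

  to-injective : ∀ {x y} → to x ≡ to y → x ≡ y
  to-injective {x} {y} e =
    trans (sym (strictlyInverseʳ x)) (trans (cong from e) (strictlyInverseʳ y))

  from≡⇒to≡ : ∀ {v x} → from v ≡ x → to x ≡ v
  from≡⇒to≡ {v} refl = strictlyInverseˡ v

  adj-toˡ : ∀ x v → adj G (to x) v ≡ E x (from v)
  adj-toˡ x v = cong (λ y → E y (from v)) (strictlyInverseʳ x)

  adj-toʳ : ∀ u y → adj G u (to y) ≡ E (from u) y
  adj-toʳ u y = cong (E (from u)) (strictlyInverseʳ y)

  edge-to : ∀ x y → E x y ≡ true → adj G (to x) (to y) ≡ true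
  edge-to x y xy = trans (adj-toˡ x (to y)) (trans (cong (E x) (strictlyInverseʳ y)) xy)

  connected-via-hub : (h : V) → (∀ x → Reachable G (to x) (to h)) → Connected G
  connected-via-hub h reach = hub⇒connected G (to h)
    (λ v → subst (λ u → Reachable G u (to h)) (strictlyInverseˡ v) (reach (from v)))

sides↔ : ∀ {k} → (Bool × Fin k) ↔ Fin (2 * k)
sides↔ = ↔-trans (↔-sym 2↔Bool ×-↔ ↔-refl) (↔-sym *↔×)

xor≡true⇒ : ∀ a b s → a xor b ≡ true → a ≡ s ⊎ b ≡ s
xor≡true⇒ true  _     true  _ = inj₁ refl
xor≡true⇒ false _     false _ = inj₁ refl
xor≡true⇒ true  false false _ = inj₂ refl
xor≡true⇒ false true  true  _ = inj₂ refl
xor≡true⇒ true  true  false ()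
xor≡true⇒ false false true  ()

xor≡false⇒≡ : ∀ a b → a xor b ≡ false → a ≡ b
xor≡false⇒≡ true  true  _ = refl
xor≡false⇒≡ false false _ = refl
xor≡false⇒≡ true  false ()
xor≡false⇒≡ false true  ()

x-xor-not-x : ∀ x → x xor not x ≡ true
x-xor-not-x true  = refl
x-xor-not-x false = refl

module CompleteBipartite (k : ℕ) where

  E : Bool × Fin k → Bool × Fin k → Bool
  E x y = proj₁ x xor proj₁ y

  E-sym : ∀ x y → E x y ≡ E y x
  E-sym x y = xor-comm (proj₁ x) (proj₁ y)

  E-irrefl : ∀ x → E x x ≡ false
  E-irrefl x = xor-same (proj₁ x)

  open EnumeratedGraph sides↔ E E-sym E-irrefl public

  side : Vertex G → Bool
  side v = proj₁ (from v)

  S : Bool → Config G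
  S s = subsetOf (λ v → side v ≟ᵇ s)

  ∈S⁺ : ∀ {s v} → side v ≡ s → v ∈ S s
  ∈S⁺ {s} = ∈-subsetOf⁺ (λ v → side v ≟ᵇ s)

  ∈S⁻ : ∀ {s v} → v ∈ S s → side v ≡ s
  ∈S⁻ {s} = ∈-subsetOf⁻ (λ v → side v ≟ᵇ s)

  side-to : ∀ s i → side (to (s , i)) ≡ s
  side-to s i = cong proj₁ (strictlyInverseʳ (s , i))

  ∣S∣≡k : ∀ s → ∣ S s ∣ ≡ k
  ∣S∣≡k s = bijection⇒∣p∣≡m (λ i → to (s , i))
    (λ {i} {j} e → cong proj₂ (to-injective {s , i} {s , j} e)) (S s)
    (λ i → ∈S⁺ (side-to s i))
    (λ {v} v∈S → proj₂ (from v) , from≡⇒to≡ (cong (_, proj₂ (from v)) (∈S⁻ v∈S)))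

  S-distinct : Fin k → S true ≢ S false
  S-distinct i S≡
    with trans (sym (side-to true i)) (∈S⁻ (subst (to (true , i) ∈_) S≡ (∈S⁺ (side-to true i))))
  ... | ()

  connected : Fin k → Connected G
  connected i₀ = connected-via-hub (true , i₀) reach
    where
    reach-false : ∀ i → Reachable G (to (false , i)) (to (true , i₀))
    reach-false i = edge-to (false , i) (true , i₀) refl ◅ reachable-refl
    reach : ∀ x → Reachable G (to x) (to (true , i₀))
    reach (true  , i) = edge-to (true , i) (false , i₀) refl ◅ reach-false i₀
    reach (false , i) = reach-false i

  S-vertexCover : ∀ s → Sol VertexCover G k (S s)
  S-vertexCover s = (λ u v uv → Sum.map ∈S⁺ ∈S⁺ (xor≡true⇒ (side u) (side v) s uv)) , ∣S∣≡k s

  S-independentSet : ∀ s → Sol IndependentSet G k (S s)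
  S-independentSet s =
    (λ u v u∈S v∈S →
      subst₂ (λ a b → a xor b ≡ false) (sym (∈S⁻ u∈S)) (sym (∈S⁻ v∈S)) (xor-same s)) ,
    ∣S∣≡k s

  S-vertexCover-rigid : ∀ s → Rigid VertexCover G k (S s)
  S-vertexCover-rigid s {D} (cover , ∣D∣≡k) {v} v∈S v∈D =
    sym (p⊆q∧∣q∣≤∣p∣⇒p≡q S⊆D (≤-reflexive (trans ∣D∣≡k (sym (∣S∣≡k s)))))
    where
    S⊆D : S s ⊆ D
    S⊆D {w} w∈S with w ∈? D
    ... | yes w∈D = w∈D
    ... | no  w∉D =
      contradiction (p⊂q⇒∣p∣<∣q∣ S′⊂D) (≤⇒≯ (≤-reflexive (trans ∣D∣≡k (sym (∣S∣≡k (not s))))))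
      where
      wx : ∀ {x} → x ∈ S (not s) → adj G w x ≡ true
      wx x∈S′ = subst₂ (λ a b → a xor b ≡ true) (sym (∈S⁻ w∈S)) (sym (∈S⁻ x∈S′)) (x-xor-not-x s)
      S′⊂D : S (not s) ⊂ D
      S′⊂D = (λ x∈S′ → [ flip contradiction w∉D , id ]′ (cover w _ (wx x∈S′))) ,
             v , v∈D , λ v∈S′ → not-¬ (∈S⁻ v∈S) (∈S⁻ v∈S′)

  S-independentSet-rigid : ∀ s → Rigid IndependentSet G k (S s)
  S-independentSet-rigid s {D} (independent , ∣D∣≡k) {v} v∈S v∈D =
    p⊆q∧∣q∣≤∣p∣⇒p≡q D⊆S (≤-reflexive (trans (∣S∣≡k s) (sym ∣D∣≡k)))
    where
    D⊆S : D ⊆ S s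
    D⊆S {w} w∈D =
      ∈S⁺ (trans (sym (xor≡false⇒≡ (side v) (side w) (independent v w v∈D w∈D))) (∈S⁻ v∈S))

vertexCover-rigidPair : ∀ k₀ → RigidPair VertexCover (suc k₀)
vertexCover-rigidPair k₀ = record
  { graph = G ; connected = connected zero ; S = S
  ; S-sol = S-vertexCover ; S-rigid = S-vertexCover-rigid ; S-distinct = S-distinct zero }
  where open CompleteBipartite (suc k₀)

independentSet-rigidPair : ∀ k₀ → RigidPair IndependentSet (suc k₀)
independentSet-rigidPair k₀ = record
  { graph = G ; connected = connected zero ; S = S
  ; S-sol = S-independentSet ; S-rigid = S-independentSet-rigid ; S-distinct = S-distinct zero }
  where open CompleteBipartite (suc k₀)

module BipartiteWithPairs (k : ℕ) where

  V : Set
  V = (Bool × Fin k) ⊎ (Fin k × Fin k)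

  coord : Bool → Fin k × Fin k → Fin k
  coord true  = proj₁
  coord false = proj₂

  -- inj₁ (s , i) is the i-th vertex of side s of K_{k,k}; the pair vertex inj₂ (p , q) is
  -- adjacent exactly to inj₁ (true , p) and inj₁ (false , q).
  E : V → V → Bool
  E (inj₁ (s , _)) (inj₁ (t , _)) = s xor t
  E (inj₁ (s , i)) (inj₂ y)       = does (i ≟ᶠ coord s y)
  E (inj₂ y)       (inj₁ (s , i)) = does (i ≟ᶠ coord s y)
  E (inj₂ _)       (inj₂ _)       = false

  E-sym : ∀ x y → E x y ≡ E y x
  E-sym (inj₁ (s , _)) (inj₁ (t , _)) = xor-comm s t
  E-sym (inj₁ _)       (inj₂ _)       = refl
  E-sym (inj₂ _)       (inj₁ _)       = refl
  E-sym (inj₂ _)       (inj₂ _)       = refl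

  E-irrefl : ∀ x → E x x ≡ false
  E-irrefl (inj₁ (s , _)) = xor-same s
  E-irrefl (inj₂ _)       = refl

  open EnumeratedGraph (↔-trans (sides↔ ⊎-↔ ↔-sym *↔×) (↔-sym +↔⊎)) E E-sym E-irrefl public

  sideOf : V → Maybe Bool
  sideOf (inj₁ (s , _)) = just s
  sideOf (inj₂ _)       = nothing

  sideOf≡just⇒ : ∀ {s} x → sideOf x ≡ just s → ∃ λ i → x ≡ inj₁ (s , i)
  sideOf≡just⇒ (inj₁ (s , i)) refl = i , refl

  S : Bool → Config G
  S s = subsetOf (λ v → ≡-decᵐ _≟ᵇ_ (sideOf (from v)) (just s))

  ∈S⁺ : ∀ {s v} → sideOf (from v) ≡ just s → v ∈ S s
  ∈S⁺ {s} = ∈-subsetOf⁺ (λ v → ≡-decᵐ _≟ᵇ_ (sideOf (from v)) (just s))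

  ∈S⁻ : ∀ {s v} → v ∈ S s → sideOf (from v) ≡ just s
  ∈S⁻ {s} = ∈-subsetOf⁻ (λ v → ≡-decᵐ _≟ᵇ_ (sideOf (from v)) (just s))

  sideOf-to : ∀ x → sideOf (from (to x)) ≡ sideOf x
  sideOf-to x = cong sideOf (strictlyInverseʳ x)

  ∣S∣≡k : ∀ s → ∣ S s ∣ ≡ k
  ∣S∣≡k s = bijection⇒∣p∣≡m (λ i → to (inj₁ (s , i)))
    (λ {i} {j} e → cong proj₂ (inj₁-injective (to-injective {inj₁ (s , i)} {inj₁ (s , j)} e))) (S s)
    (λ i → ∈S⁺ (sideOf-to (inj₁ (s , i))))
    (λ {v} v∈S → let i , from-v≡ = sideOf≡just⇒ (from v) (∈S⁻ v∈S) in i , from≡⇒to≡ from-v≡)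

  S-distinct : Fin k → S true ≢ S false
  S-distinct i S≡ with trans (sym (sideOf-to a)) (∈S⁻ (subst (to a ∈_) S≡ (∈S⁺ (sideOf-to a))))
    where a = inj₁ (true , i)
  ... | ()

  connected : Fin k → Connected G
  connected i₀ = connected-via-hub hub reach
    where
    hub = inj₁ (true , i₀)
    reach-false : ∀ i → Reachable G (to (inj₁ (false , i))) (to hub)
    reach-false i = edge-to (inj₁ (false , i)) hub refl ◅ reachable-refl
    reach-true : ∀ i → Reachable G (to (inj₁ (true , i))) (to hub)
    reach-true i = edge-to (inj₁ (true , i)) (inj₁ (false , i₀)) refl ◅ reach-false i₀
    reach : ∀ x → Reachable G (to x) (to hub)
    reach (inj₁ (true  , i)) = reach-true i
    reach (inj₁ (false , i)) = reach-false i
    reach (inj₂ (p , q))     =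
      edge-to (inj₂ (p , q)) (inj₁ (true , p)) (dec-true (p ≟ᶠ p) refl) ◅ reach-true p

  dominated : ∀ s x → sideOf x ≡ just s ⊎ ∃ λ i → E (inj₁ (s , i)) x ≡ true
  dominated true  (inj₁ (true  , _)) = inj₁ refl
  dominated true  (inj₁ (false , j)) = inj₂ (j , refl)
  dominated false (inj₁ (true  , j)) = inj₂ (j , refl)
  dominated false (inj₁ (false , _)) = inj₁ refl
  dominated s     (inj₂ y)           = inj₂ (coord s y , dec-true (coord s y ≟ᶠ coord s y) refl)

  S-dominatingSet : ∀ s → Sol DominatingSet G k (S s)
  S-dominatingSet s = (λ v → Sum.map ∈S⁺ (dominator v) (dominated s (from v))) , ∣S∣≡k s
    where
    dominator : ∀ v → (∃ λ i → E (inj₁ (s , i)) (from v) ≡ true) →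
                Σ (Vertex G) λ u → u ∈ S s × adj G u v ≡ true
    dominator v (i , e) =
      to (inj₁ (s , i)) , ∈S⁺ (sideOf-to (inj₁ (s , i))) , trans (adj-toˡ (inj₁ (s , i)) v) e

  pair : Bool → Fin k → Fin k → Fin k × Fin k
  pair true  l j = l , j
  pair false l j = j , l

  coord-pair : ∀ s t l j →
    (t , coord t (pair s l j)) ≡ (s , l) ⊎ (t , coord t (pair s l j)) ≡ (not s , j)
  coord-pair true  true  l j = inj₁ refl
  coord-pair true  false l j = inj₂ refl
  coord-pair false true  l j = inj₂ refl
  coord-pair false false l j = inj₁ refl

  pair-neighbours : ∀ s l j x → E x (inj₂ (pair s l j)) ≡ true →
                    x ≡ inj₁ (s , l) ⊎ x ≡ inj₁ (not s , j)
  pair-neighbours s l j (inj₁ (t , i)) e with i ≟ᶠ coord t (pair s l j) | e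
  ... | yes refl | _ = Sum.map (cong inj₁) (cong inj₁) (coord-pair s t l j)
  ... | no  _    | ()
  pair-neighbours s l j (inj₂ _) ()

  -- What a dominating set missing inj₁ (s , l) must contain to dominate the pair vertex of
  -- (s , l) and (not s , j); the flag says whether it contains inj₁ (not s , j).
  witness : Bool → Fin k → Fin k → Bool → V
  witness s l j true  = inj₁ (not s , j)
  witness s l j false = inj₂ (pair s l j)

  opposite : Bool → V → Fin k
  opposite s (inj₁ (_ , j)) = j
  opposite s (inj₂ y)       = coord (not s) y

  opposite-witness : ∀ s l j b → opposite s (witness s l j b) ≡ j
  opposite-witness s     l j true  = refl
  opposite-witness true  l j false = refl
  opposite-witness false l j false = refl

  witness-off-side : ∀ s l j b → sideOf (witness s l j b) ≢ just s
  witness-off-side s l j true  e = not-¬ refl (sym (just-injective e))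
  witness-off-side s l j false ()

  witness∈D : ∀ {D s l j} → IsFeasible DominatingSet G D → to (inj₁ (s , l)) ∉ D →
              (b? : Dec (to (inj₁ (not s , j)) ∈ D)) → to (witness s l j (does b?)) ∈ D
  witness∈D dom a∉D (yes b∈D) = b∈D
  witness∈D {D} {s} {l} {j} dom a∉D (no b∉D) with dom (to (inj₂ (pair s l j)))
  ... | inj₁ y∈D = y∈D
  ... | inj₂ (u , u∈D , uy)
    with pair-neighbours s l j (from u) (trans (sym (adj-toʳ u (inj₂ (pair s l j)))) uy)
  ...   | inj₁ u≡a = contradiction (subst (_∈ D) (sym (from≡⇒to≡ u≡a)) u∈D) a∉D
  ...   | inj₂ u≡b = contradiction (subst (_∈ D) (sym (from≡⇒to≡ u≡b)) u∈D) b∉D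

  a∉D⇒k≤∣D─S∣ : ∀ {D s l} → IsFeasible DominatingSet G D → to (inj₁ (s , l)) ∉ D → k ≤ ∣ D ─ S s ∣
  a∉D⇒k≤∣D─S∣ {D} {s} {l} dom a∉D = injective⇒m≤∣p∣ h h-injective (D ─ S s) h∈D─S
    where
    choice : Fin k → Bool
    choice j = does (to (inj₁ (not s , j)) ∈? D)
    w : Fin k → V
    w j = witness s l j (choice j)
    h : Fin k → Vertex G
    h j = to (w j)
    h-injective : Injective _≡_ _≡_ h
    h-injective {i} {j} e = begin
      i                ≡⟨ opposite-witness s l i (choice i) ⟨
      opposite s (w i) ≡⟨ cong (opposite s) (to-injective {w i} {w j} e) ⟩
      opposite s (w j) ≡⟨ opposite-witness s l j (choice j) ⟩
      j                ∎
      where open ≡-Reasoning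
    h∈D─S : ∀ j → h j ∈ D ─ S s
    h∈D─S j = x∈p∧x∉q⇒x∈p─q (witness∈D {D} {s} {l} {j} dom a∉D (to (inj₁ (not s , j)) ∈? D))
      (λ h∈S → witness-off-side s l j (choice j) (trans (sym (sideOf-to (w j))) (∈S⁻ h∈S)))

  S-dominatingSet-rigid : ∀ s → Rigid DominatingSet G k (S s)
  S-dominatingSet-rigid s {D} (dom , ∣D∣≡k) {v} v∈S v∈D =
    sym (p⊆q∧∣q∣≤∣p∣⇒p≡q S⊆D (≤-reflexive (trans ∣D∣≡k (sym (∣S∣≡k s)))))
    where
    ∣D─S∣<k : ∣ D ─ S s ∣ < k
    ∣D─S∣<k = subst (∣ D ─ S s ∣ <_) ∣D∣≡k (p∩q≢∅⇒∣p─q∣<∣p∣ D (S s) (v , x∈p∩q⁺ (v∈D , v∈S)))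
    S⊆D : S s ⊆ D
    S⊆D {w} w∈S with w ∈? D | sideOf≡just⇒ (from w) (∈S⁻ w∈S)
    ... | yes w∈D | _        = w∈D
    ... | no  w∉D | l , w≡a  =
      contradiction (a∉D⇒k≤∣D─S∣ dom (subst (_∉ D) (sym (from≡⇒to≡ w≡a)) w∉D)) (<⇒≱ ∣D─S∣<k)

dominatingSet-rigidPair : ∀ k₀ → RigidPair DominatingSet (suc k₀)
dominatingSet-rigidPair k₀ = record
  { graph = G ; connected = connected zero ; S = S
  ; S-sol = S-dominatingSet ; S-rigid = S-dominatingSet-rigid ; S-distinct = S-distinct zero }
  where open BipartiteWithPairs (suc k₀)

rigidPair : ∀ Π k₀ → RigidPair Π (suc k₀)
rigidPair VertexCover    = vertexCover-rigidPair
rigidPair DominatingSet  = dominatingSet-rigidPair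
rigidPair IndependentSet = independentSet-rigidPair

proposition1 : (k : ℕ) → 2 ≤ k → (Π : Problem) →
    Σ Graph λ G → Connected G × Σ (Config G) λ D₁ → Σ (Config G) λ D₂ →
      Sol Π G k D₁ × Sol Π G k D₂ ×
      ((d : ℕ) → 1 ≤ d →
        ¬ Reconf Π G k (k ∸ 1) d D₁ D₂ × ¬ Reconf Π G k (k ∸ 1) d D₂ D₁)
proposition1 (suc k₀) _ Π =
  graph , connected , S true , S false , S-sol true , S-sol false ,
  λ d _ → (λ r → S-distinct (sym (frozen true r))) , (λ r → S-distinct (frozen false r))
  where
  open RigidPair (rigidPair Π k₀)
  frozen : ∀ s {d D} → Reconf Π graph (suc k₀) k₀ d (S s) D → D ≡ S s
  frozen s = reconf-from-rigid (S-rigid s) (n<1+n k₀)
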